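{- Suppose $G$ is a Moore graph of diameter $2$ and degree $57$. Fix two adjacent vertices $a,b$ of $G$ and let $\Gamma$ be the subgraph of $G$ induced by the set of vertices at distance exactly $2$ from both $a$ and $b$ in $G$. For vertices $p,q$ of $\Gamma$ let $d(p,q)$ denote their distance in $\Gamma$. For vertices $u,v,w$ of $\Gamma$ and integers $i,j,k$, let $N(i,j,k;u,v,w)$ be the number of vertices $z$ of $\Gamma$ with $d(z,u)=i$, $d(z,v)=j$, $d(z,w)=k$. Let $u,v,w$ be distinct vertices of $\Gamma$ with $U=d(v,w)$, $V=d(u,w)$, $W=d(u,v)$. Then: (a) if $U=3$ and $V=W=2$, then $N(1,3,3;u,v,w)=1$; (b) if $U=V=W=2$, then each of $N(1,3,3;u,v,w)$, $N(2,3,3;u,v,w)$, $N(3,1,3;u,v,w)$, $N(3,2,3;u,v,w)$, $N(3,3,1;u,v,w)$, $N(3,3,2;u,v,w)$ is at most $2$.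
   Context: A Moore graph of diameter 2 and degree $d$ is a $d$-regular graph of diameter $2$ and girth $5$ (it has $d^2+1$ vertices); for $d=57$ it has $3250$ vertices. The graph $\Gamma$ defined in the statement is connected of diameter $3$ (it is distance-regular with intersection array $[55,54,2;1,1,54]$), so all distances between distinct vertices of $\Gamma$ lie in $\{1,2,3\}$. -}

module Defs where

open import Data.Nat using (ℕ; zero; suc; _<_; _≤_)
open import Data.Fin using (Fin; inject₁; fromℕ) renaming (zero to fzero; suc to fsuc)
open import Data.List using (List; length)
open import Data.List.Relation.Unary.All using (All)
open import Data.List.Relation.Unary.Unique.Propositional using (Unique)
open import Data.List.Membership.Propositional using (_∈_)
open import Data.Product using (Σ; ∃; ∃-syntax; _×_)
open import Data.Unit using (⊤)
open import Function.Definitions using (Injective)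
open import Function.Bundles using (_⇔_)
open import Relation.Binary.PropositionalEquality using (_≡_)
open import Relation.Nullary using (¬_)
open import Relation.Binary.Definitions using (Decidable)

record Graph (V : Set) : Set₁ where
  field
    Adj    : V → V → Set
    adj?   : Decidable Adj
    sym    : ∀ {x y} → Adj x y → Adj y x
    irrefl : ∀ {x} → ¬ Adj x x

open Graph public

CountIs : {V : Set} → (V → Set) → ℕ → Set
CountIs {V} P c = Σ (List V) λ l → Unique l × (∀ z → (z ∈ l) ⇔ P z) × length l ≡ c

AtMost : {V : Set} → (V → Set) → ℕ → Set
AtMost {V} P c = ∀ (l : List V) → Unique l → All P l → length l ≤ c

-- Walks of length k in G from x to y all of whose vertices satisfy P
-- (P = everything: walks in G; P = S: walks in the subgraph induced by S).
data Walk {V : Set} (G : Graph V) (P : V → Set) : V → V → ℕ → Set where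
  here : ∀ {x} → P x → Walk G P x x 0
  step : ∀ {x y z k} → P x → Adj G x y → Walk G P y z k → Walk G P x z (suc k)

DistIn : {V : Set} → Graph V → (V → Set) → V → V → ℕ → Set
DistIn G P x y k = Walk G P x y k × (∀ j → j < k → ¬ Walk G P x y j)

Dist : {V : Set} → Graph V → V → V → ℕ → Set
Dist G = DistIn G (λ _ → ⊤)

Regular : {V : Set} → Graph V → ℕ → Set
Regular G d = ∀ v → CountIs (Adj G v) d

Diameter : {V : Set} → Graph V → ℕ → Set
Diameter G D = (∀ x y → ∃[ k ] (k ≤ D × Dist G x y k)) × (∃[ x ] ∃[ y ] Dist G x y D)

-- A cycle of length m+3: injective map Fin (m+3) → V with consecutive
-- vertices adjacent (cyclically).
Cycle : {V : Set} → Graph V → ℕ → Set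
Cycle {V} G m = Σ (Fin (suc (suc (suc m))) → V) λ c →
  Injective _≡_ _≡_ c
  × (∀ (i : Fin (suc (suc m))) → Adj G (c (inject₁ i)) (c (fsuc i)))
  × Adj G (c (fromℕ (suc (suc m)))) (c fzero)

Girth : {V : Set} → Graph V → ℕ → Set
Girth G g = Σ ℕ λ m → (g ≡ suc (suc (suc m))) × Cycle G m
            × (∀ m' → suc (suc (suc m')) < g → ¬ Cycle G m')

IsMooreDiam2 : {V : Set} → Graph V → ℕ → Set
IsMooreDiam2 G d = Regular G d × Diameter G 2 × Girth G 5

InΓ : {V : Set} → Graph V → V → V → V → Set
InΓ G a b z = Dist G z a 2 × Dist G z b 2

dΓ : {V : Set} → Graph V → V → V → V → V → ℕ → Set
dΓ G a b = DistIn G (InΓ G a b)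

NPred : {V : Set} → Graph V → V → V → ℕ → ℕ → ℕ → V → V → V → V → Set
NPred G a b i j k u v w z =
  InΓ G a b z × dΓ G a b z u i × dΓ G a b z v j × dΓ G a b z w k

-- Only three properties of G are used: any two distinct non-adjacent vertices have a common
-- neighbour (diameter 2), two distinct vertices have at most one common neighbour (no 3- or
-- 4-cycles), and every vertex has more than three neighbours.  A vertex of Γ is a vertex
-- equal or adjacent to neither a nor b.  If d(x,y) = 3 in Γ, then the common neighbour of x
-- and y in G lies outside Γ, hence is adjacent to a or b; if d(v,w) = 2 in Γ, no common
-- neighbour of v and w is adjacent to a or b.
-- (a) If v, w have the common neighbour c ~ a, the unique common neighbour z of u and c is the
-- only vertex counted: every counted vertex reaches v or w through c.
-- (b) A vertex z at distance 3 from v and w reaches v and w through neighbours of different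
-- ends of the edge ab; for each choice of ends, z is a common neighbour of the (distinct)
-- neighbour of v adjacent to one end and the neighbour of w adjacent to the other, so there
-- are at most two such z.

module Submission where

open import Defs
open import Data.Nat using (ℕ; zero; suc; _≤_; _<_; _+_; z≤n; s≤s)
open import Data.Nat.Properties using (+-mono-≤; +-suc; <⇒≱)
open import Data.Fin using (Fin; _≟_; inject₁) renaming (zero to fzero; suc to fsuc)
open import Data.List using (List; []; _∷_; length)
open import Data.List.Relation.Unary.All as All using (All; []; _∷_)
open import Data.List.Relation.Unary.All.Properties using (¬All⇒Any¬)
open import Data.List.Relation.Unary.Any using (here)
open import Data.List.Relation.Unary.AllPairs using ([]; _∷_)
open import Data.List.Relation.Unary.Unique.Propositional using (Unique)
open import Data.List.Relation.Binary.Sublist.Propositional using (_⊆_; []; _∷_; _∷ʳ_)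
open import Data.List.Relation.Binary.Sublist.Propositional.Properties using (All-resp-⊆)
open import Data.List.Membership.Propositional using (find)
open import Data.Vec using (Vec; []; _∷_; lookup)
open import Data.Vec.Relation.Unary.Unique.Propositional using () renaming (Unique to UniqueVec)
open import Data.Vec.Relation.Unary.All using ([]; _∷_)
open import Data.Vec.Relation.Unary.AllPairs using ([]; _∷_)
open import Data.Vec.Relation.Unary.Unique.Propositional.Properties using (lookup-injective)
open import Data.Product using (Σ; ∃; ∃-syntax; _×_; _,_; proj₁; proj₂)
open import Data.Sum as Sum using (_⊎_; inj₁; inj₂)
open import Data.Empty using (⊥; ⊥-elim)
open import Function using (_∘_)
open import Function.Bundles using (mk⇔; Equivalence)
open import Relation.Binary.Definitions using (DecidableEquality)
open import Relation.Binary.PropositionalEquality as ≡ using (_≡_; _≢_; refl; subst; ≢-sym)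
open import Relation.Nullary using (¬_; Dec; yes; no)
open import Relation.Nullary.Decidable using (_⊎-dec_)

module _ {A : Set} where

  Subsingleton : (A → Set) → Set
  Subsingleton P = ∀ {x y} → P x → P y → x ≡ y

  subsingleton⇒atMost-1 : ∀ {P : A → Set} → Subsingleton P → AtMost P 1
  subsingleton⇒atMost-1 P! []          _               _             = z≤n
  subsingleton⇒atMost-1 P! (_ ∷ [])    _               _             = s≤s z≤n
  subsingleton⇒atMost-1 P! (_ ∷ _ ∷ _) ((x≢y ∷ _) ∷ _) (px ∷ py ∷ _) = ⊥-elim (x≢y (P! px py))

  atMost-mono : ∀ {P Q : A → Set} {k} → (∀ {x} → P x → Q x) → AtMost Q k → AtMost P k
  atMost-mono P⇒Q atMost l unique all = atMost l unique (All.map P⇒Q all)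

  Unique-resp-⊇ : ∀ {xs ys : List A} → xs ⊆ ys → Unique ys → Unique xs
  Unique-resp-⊇ []           []             = []
  Unique-resp-⊇ (_ ∷ʳ xs⊆ys) (_ ∷ unique)   = Unique-resp-⊇ xs⊆ys unique
  Unique-resp-⊇ (refl ∷ xs⊆ys) (x∉ ∷ unique) = All-resp-⊆ xs⊆ys x∉ ∷ Unique-resp-⊇ xs⊆ys unique

  partition-⊎ : ∀ {E R : A → Set} {l : List A} → All (λ x → E x ⊎ R x) l →
                Σ (List A) λ es → Σ (List A) λ rs →
                es ⊆ l × rs ⊆ l × All E es × All R rs × length l ≡ length es + length rs
  partition-⊎ [] = [] , [] , [] , [] , [] , [] , refl
  partition-⊎ {l = x ∷ _} (inj₁ e ∷ all) with partition-⊎ all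
  ... | es , rs , es⊆ , rs⊆ , allE , allR , len =
    x ∷ es , rs , refl ∷ es⊆ , x ∷ʳ rs⊆ , e ∷ allE , allR , ≡.cong suc len
  partition-⊎ {l = x ∷ _} (inj₂ r ∷ all) with partition-⊎ all
  ... | es , rs , es⊆ , rs⊆ , allE , allR , len =
    es , x ∷ rs , x ∷ʳ es⊆ , refl ∷ rs⊆ , allE , r ∷ allR ,
    ≡.trans (≡.cong suc len) (≡.sym (+-suc (length es) (length rs)))

  atMost-⊎ : ∀ {E R : A → Set} {i j} → AtMost E i → AtMost R j → AtMost (λ x → E x ⊎ R x) (i + j)
  atMost-⊎ {i = i} {j} atMostE atMostR l unique all with partition-⊎ all
  ... | es , rs , es⊆ , rs⊆ , allE , allR , len =
    subst (_≤ i + j) (≡.sym len)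
      (+-mono-≤ (atMostE es (Unique-resp-⊇ es⊆ unique) allE)
                (atMostR rs (Unique-resp-⊇ rs⊆ unique) allR))

module _ {V : Set} {G : Graph V} {P : V → Set} where

  walk₀⇒≡ : ∀ {x y} → Walk G P x y 0 → x ≡ y
  walk₀⇒≡ (here _) = refl

  walk₁⇒adj : ∀ {x y} → Walk G P x y 1 → Adj G x y
  walk₁⇒adj (step _ xy (here _)) = xy

  walk₂⇒middle : ∀ {x y} → Walk G P x y 2 → ∃ λ p → Adj G x p × Adj G p y × P p
  walk₂⇒middle (step _ xp (step pp py (here _))) = _ , xp , py , pp

  walk-source : ∀ {x y k} → Walk G P x y k → P x
  walk-source (here px)     = px
  walk-source (step px _ _) = px

  walk-target : ∀ {x y k} → Walk G P x y k → P y
  walk-target (here py)       = py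
  walk-target (step _ _ walk) = walk-target walk

  dist-suc⇒≢ : ∀ {x y k} → DistIn G P x y (suc k) → x ≢ y
  dist-suc⇒≢ (walk , shortest) refl = shortest 0 (s≤s z≤n) (here (walk-source walk))

  dist-2+⇒¬adj : ∀ {x y k} → DistIn G P x y (suc (suc k)) → ¬ Adj G x y
  dist-2+⇒¬adj (walk , shortest) xy =
    shortest 1 (s≤s (s≤s z≤n)) (step (walk-source walk) xy (here (walk-target walk)))

  dist₃⇒¬middle : ∀ {x y p} → DistIn G P x y 3 → Adj G x p → Adj G p y → ¬ P p
  dist₃⇒¬middle (walk , shortest) xp py pp =
    shortest 2 (s≤s (s≤s (s≤s z≤n)))
      (step (walk-source walk) xp (step pp py (here (walk-target walk))))

  adj⇒dist₁ : ∀ {x y} → P x → P y → Adj G x y → DistIn G P x y 1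
  adj⇒dist₁ px py xy = step px xy (here py) , λ where
    zero    _       walk → irrefl G (subst (Adj G _) (≡.sym (walk₀⇒≡ walk)) xy)
    (suc _) (s≤s ()) _

  dist₃-intro : ∀ {x y} → Walk G P x y 3 → x ≢ y → ¬ Adj G x y →
                (∀ {p} → Adj G x p → Adj G p y → ¬ P p) → DistIn G P x y 3
  dist₃-intro walk x≢y x≁y no-middle = walk , λ where
    zero                _                      walk₀ → x≢y (walk₀⇒≡ walk₀)
    (suc zero)          _                      walk₁ → x≁y (walk₁⇒adj walk₁)
    (suc (suc zero))    _                      walk₂ →
      let (_ , xp , py , pp) = walk₂⇒middle walk₂ in no-middle xp py pp
    (suc (suc (suc _))) (s≤s (s≤s (s≤s ()))) _

module GirthFiveDiameterTwo {V : Set} (_≟V_ : DecidableEquality V) (G : Graph V)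
    (diameter≤2 : ∀ x y → ∃[ k ] (k ≤ 2 × Dist G x y k))
    (no-short-cycle : ∀ m → suc (suc (suc m)) < 5 → ¬ Cycle G m) where

  private
    _~_ : V → V → Set
    _~_ = Adj G

  ≢-if-≁ : ∀ {x y z} → x ~ z → ¬ y ~ z → x ≢ y
  ≢-if-≁ xz y≁z refl = y≁z xz

  ~-sym : ∀ {x y} → x ~ y → y ~ x
  ~-sym = Graph.sym G

  ≁-sym : ∀ {x y} → ¬ x ~ y → ¬ y ~ x
  ≁-sym x≁y = x≁y ∘ ~-sym

  adj⇒≢ : ∀ {x y} → x ~ y → x ≢ y
  adj⇒≢ xy refl = irrefl G xy

  no-triangle : ∀ {x y z} → x ~ y → y ~ z → z ~ x → ⊥
  no-triangle {x} {y} {z} xy yz zx =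
    no-short-cycle 0 (s≤s (s≤s (s≤s (s≤s z≤n))))
      (lookup cycle , (λ {i} {j} → lookup-injective distinct i j) , consecutive , zx)
    where
      cycle : Vec V 3
      cycle = x ∷ y ∷ z ∷ []
      distinct : UniqueVec cycle
      distinct = (adj⇒≢ xy ∷ ≢-sym (adj⇒≢ zx) ∷ []) ∷ (adj⇒≢ yz ∷ []) ∷ [] ∷ []
      consecutive : ∀ (i : Fin 2) → lookup cycle (inject₁ i) ~ lookup cycle (fsuc i)
      consecutive fzero        = xy
      consecutive (fsuc fzero) = yz

  no-quadrangle : ∀ {x y p q} → x ≢ y → p ≢ q → x ~ p → p ~ y → y ~ q → q ~ x → ⊥
  no-quadrangle {x} {y} {p} {q} x≢y p≢q xp py yq qx =
    no-short-cycle 1 (s≤s (s≤s (s≤s (s≤s (s≤s z≤n)))))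
      (lookup cycle , (λ {i} {j} → lookup-injective distinct i j) , consecutive , qx)
    where
      cycle : Vec V 4
      cycle = x ∷ p ∷ y ∷ q ∷ []
      distinct : UniqueVec cycle
      distinct = (adj⇒≢ xp ∷ x≢y ∷ ≢-sym (adj⇒≢ qx) ∷ [])
               ∷ (adj⇒≢ py ∷ p≢q ∷ []) ∷ (adj⇒≢ yq ∷ []) ∷ [] ∷ []
      consecutive : ∀ (i : Fin 3) → lookup cycle (inject₁ i) ~ lookup cycle (fsuc i)
      consecutive fzero               = xp
      consecutive (fsuc fzero)        = py
      consecutive (fsuc (fsuc fzero)) = yq

  CommonNeighbour : V → V → V → Set
  CommonNeighbour x y p = x ~ p × p ~ y

  common-neighbour-unique : ∀ {x y} → x ≢ y → Subsingleton (CommonNeighbour x y)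
  common-neighbour-unique x≢y {p} {q} (xp , py) (xq , qy) with p ≟V q
  ... | yes p≡q = p≡q
  ... | no  p≢q = ⊥-elim (no-quadrangle x≢y p≢q xp py (~-sym qy) (~-sym xq))

  dist₂-intro : ∀ {x y} → x ≢ y → ¬ x ~ y → Dist G x y 2
  dist₂-intro {x} {y} x≢y x≁y with diameter≤2 x y
  ... | zero                , _                 , walk , _ = ⊥-elim (x≢y (walk₀⇒≡ walk))
  ... | suc zero            , _                 , walk , _ = ⊥-elim (x≁y (walk₁⇒adj walk))
  ... | suc (suc zero)      , _                 , dist     = dist
  ... | suc (suc (suc _))   , s≤s (s≤s ())      , _

  common-neighbour : ∀ {x y} → x ≢ y → ¬ x ~ y → ∃ (CommonNeighbour x y)
  common-neighbour x≢y x≁y =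
    let (p , xp , py , _) = walk₂⇒middle (proj₁ (dist₂-intro x≢y x≁y)) in p , xp , py

  private
    adjacent-to-one-of? : ∀ e f q p → Dec (p ~ e ⊎ p ~ f ⊎ p ~ q)
    adjacent-to-one-of? e f q p = adj? G p e ⊎-dec adj? G p f ⊎-dec adj? G p q

  neighbours-adjacent-to-one-of-three-atMost-3 : ∀ {x e f q} → x ≢ e → x ≢ f → x ≢ q →
    AtMost (λ p → x ~ p × (p ~ e ⊎ p ~ f ⊎ p ~ q)) 3
  neighbours-adjacent-to-one-of-three-atMost-3 x≢e x≢f x≢q =
    atMost-mono distribute (atMost-⊎ (at-most-one x≢e) (atMost-⊎ (at-most-one x≢f) (at-most-one x≢q)))
    where
      distribute : ∀ {x e f q p} → x ~ p × (p ~ e ⊎ p ~ f ⊎ p ~ q) →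
                   CommonNeighbour x e p ⊎ CommonNeighbour x f p ⊎ CommonNeighbour x q p
      distribute (xp , hit) = Sum.map (xp ,_) (Sum.map (xp ,_) (xp ,_)) hit
      at-most-one : ∀ {x y} → x ≢ y → AtMost (CommonNeighbour x y) 1
      at-most-one x≢y = subsingleton⇒atMost-1 (common-neighbour-unique x≢y)

  neighbour-avoiding : ∀ {d} → Regular G d → 3 < d → ∀ {x e f q} → x ≢ e → x ≢ f → x ≢ q →
                       ∃ λ p → x ~ p × ¬ p ~ e × ¬ p ~ f × ¬ p ~ q
  neighbour-avoiding regular 3<d {x} {e} {f} {q} x≢e x≢f x≢q with regular x
  ... | neighbours , unique , mem , len with All.all? (adjacent-to-one-of? e f q) neighbours
  ... | yes all-hit =
    ⊥-elim (<⇒≱ 3<d (subst (_≤ 3) len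
      (neighbours-adjacent-to-one-of-three-atMost-3 x≢e x≢f x≢q neighbours unique
        (All.zip (All.tabulate (Equivalence.to (mem _)) , all-hit)))))
  ... | no ¬all-hit with find (¬All⇒Any¬ (adjacent-to-one-of? e f q) neighbours ¬all-hit)
  ...   | p , p∈ , misses =
    p , Equivalence.to (mem p) p∈ , misses ∘ inj₁ , misses ∘ inj₂ ∘ inj₁ , misses ∘ inj₂ ∘ inj₂

  record Far (e f z : V) : Set where
    field
      ≢e : z ≢ e
      ≢f : z ≢ f
      ≁e : ¬ z ~ e
      ≁f : ¬ z ~ f

  Far-swap : ∀ {e f z} → Far e f z → Far f e z
  Far-swap far = record { ≢e = Far.≢f far ; ≢f = Far.≢e far ; ≁e = Far.≁f far ; ≁f = Far.≁e far }

  InΓ⇒Far : ∀ {e f z} → InΓ G e f z → Far e f z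
  InΓ⇒Far (ze , zf) = record
    { ≢e = dist-suc⇒≢ ze ; ≢f = dist-suc⇒≢ zf ; ≁e = dist-2+⇒¬adj ze ; ≁f = dist-2+⇒¬adj zf }

  Far⇒InΓ : ∀ {e f z} → Far e f z → InΓ G e f z
  Far⇒InΓ far = dist₂-intro (Far.≢e far) (Far.≁e far) , dist₂-intro (Far.≢f far) (Far.≁f far)

  Via : V → V → V → Set
  Via t x y = ∃ λ c → CommonNeighbour x y c × c ~ t

  Via-both : ∀ {t z v w} → z ≢ t → Via t z v → Via t z w → Via t v w
  Via-both z≢t (c₁ , (zc₁ , c₁v) , c₁t) (c₂ , (zc₂ , c₂w) , c₂t)
    with common-neighbour-unique z≢t (zc₁ , c₁t) (zc₂ , c₂t)
  ... | refl = c₁ , (~-sym c₁v , c₂w) , c₁t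

  -- P is any predicate equivalent to Far e f, so that Γ can be used with both orientations of ab.
  module Oriented {d} (regular : Regular G d) (3<d : 3 < d) {e f} (ef : e ~ f) {P : V → Set}
                  (P⇒Far : ∀ {z} → P z → Far e f z) (Far⇒P : ∀ {z} → Far e f z → P z) where

    neighbour-≢e : ∀ {x p} → P x → x ~ p → p ≢ e
    neighbour-≢e px xp = ≢-if-≁ (~-sym xp) (≁-sym (Far.≁e (P⇒Far px)))

    neighbour-≢f : ∀ {x p} → P x → x ~ p → p ≢ f
    neighbour-≢f px xp = ≢-if-≁ (~-sym xp) (≁-sym (Far.≁f (P⇒Far px)))

    neighbour-in-P : ∀ {x p} → P x → x ~ p → ¬ p ~ e → ¬ p ~ f → P p
    neighbour-in-P px xp p≁e p≁f = Far⇒P record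
      { ≢e = neighbour-≢e px xp ; ≢f = neighbour-≢f px xp ; ≁e = p≁e ; ≁f = p≁f }

    dist₂⇒¬Via-e : ∀ {v w} → DistIn G P v w 2 → ¬ Via e v w
    dist₂⇒¬Via-e dist (c , vcw , ce) with walk₂⇒middle (proj₁ dist)
    ... | p , vp , pw , pp with common-neighbour-unique (dist-suc⇒≢ dist) vcw (vp , pw)
    ... | refl = Far.≁e (P⇒Far pp) ce

    dist₃⇒Via : ∀ {x y} → DistIn G P x y 3 → Via e x y ⊎ Via f x y
    dist₃⇒Via dist with common-neighbour (dist-suc⇒≢ dist) (dist-2+⇒¬adj dist)
    ... | c , xc , cy with adj? G c e | adj? G c f
    ... | yes ce | _      = inj₁ (c , (xc , cy) , ce)
    ... | no _   | yes cf = inj₂ (c , (xc , cy) , cf)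
    ... | no c≁e | no c≁f =
      ⊥-elim (dist₃⇒¬middle dist xc cy (neighbour-in-P (walk-source (proj₁ dist)) xc c≁e c≁f))


    Via-e-f-unique : ∀ {v w} → P v → P w → Subsingleton (λ z → Via e z v × Via f z w)
    Via-e-f-unique pv pw ((c₁ , (zc₁ , c₁v) , c₁e) , (c₂ , (zc₂ , c₂w) , c₂f))
                         ((d₁ , (z'd₁ , d₁v) , d₁e) , (d₂ , (z'd₂ , d₂w) , d₂f))
      with common-neighbour-unique (Far.≢e (P⇒Far pv)) (~-sym c₁v , c₁e) (~-sym d₁v , d₁e)
         | common-neighbour-unique (Far.≢f (P⇒Far pw)) (~-sym c₂w , c₂f) (~-sym d₂w , d₂f)
    ... | refl | refl = common-neighbour-unique c₁≢c₂ (~-sym zc₁ , zc₂) (~-sym z'd₁ , z'd₂)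
      where
        c₁≢c₂ : c₁ ≢ c₂
        c₁≢c₂ refl = no-triangle c₁e ef (~-sym c₂f)

    Via-e-hub : ∀ {z t c} → P t → t ~ c → c ~ e → Via e z t → z ~ c
    Via-e-hub pt tc ce (h , (zh , ht) , he)
      with common-neighbour-unique (Far.≢e (P⇒Far pt)) (~-sym ht , he) (tc , ce)
    ... | refl = zh

    walk₂-missing-hubs : ∀ {p y} → P p → P y → p ≢ y → ¬ p ~ y →
                         (∀ {h} → y ~ h → h ~ e → ¬ p ~ h) → (∀ {h} → y ~ h → h ~ f → ¬ p ~ h) →
                         Walk G P p y 2
    walk₂-missing-hubs pp py p≢y p≁y e-hub f-hub with common-neighbour p≢y p≁y
    ... | q , pq , qy = step pp pq (step pq' qy (here py))
      where
        pq' = neighbour-in-P py (~-sym qy) (λ qe → e-hub (~-sym qy) qe pq)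
                                           (λ qf → f-hub (~-sym qy) qf pq)

    -- Step from x to a neighbour p missing e, f and the neighbour q₀ of y adjacent to f; then p
    -- also misses c, the neighbour of y adjacent to e (no triangle x p c), so it reaches y in
    -- two steps.
    walk₃-around : ∀ {x y c} → P x → P y → x ≢ y → x ~ c → c ~ y → c ~ e → Walk G P x y 3
    walk₃-around {x} {y} {c} px py x≢y xc cy ce
      with common-neighbour (Far.≢f (P⇒Far py)) (Far.≁f (P⇒Far py))
    ... | q₀ , yq₀ , q₀f
      with neighbour-avoiding regular 3<d (Far.≢e (P⇒Far px)) (Far.≢f (P⇒Far px))
                              (≢-sym (≢-if-≁ q₀f (Far.≁f (P⇒Far px))))
    ... | p , xp , p≁e , p≁f , p≁q₀ =
      step px xp (walk₂-missing-hubs (neighbour-in-P px xp p≁e p≁f) py p≢y p≁y e-hub f-hub)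
      where
        p≢y : p ≢ y
        p≢y refl = no-triangle xp (~-sym cy) (~-sym xc)
        p≁y : ¬ p ~ y
        p≁y py = no-quadrangle x≢y (≢-sym (≢-if-≁ ce p≁e)) xp py (~-sym cy) (~-sym xc)
        e-hub : ∀ {h} → y ~ h → h ~ e → ¬ p ~ h
        e-hub yh he with common-neighbour-unique (Far.≢e (P⇒Far py)) (yh , he) (~-sym cy , ce)
        ... | refl = λ pc → no-triangle xp pc (~-sym xc)
        f-hub : ∀ {h} → y ~ h → h ~ f → ¬ p ~ h
        f-hub yh hf with common-neighbour-unique (Far.≢f (P⇒Far py)) (yh , hf) (yq₀ , q₀f)
        ... | refl = p≁q₀

    Via-e⇒dist₃ : ∀ {z t} → P z → P t → z ≢ t → Via e z t → DistIn G P z t 3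
    Via-e⇒dist₃ pz pt z≢t (c , (zc , ct) , ce) =
      dist₃-intro (walk₃-around pz pt z≢t zc ct ce) z≢t
        (λ zt → no-triangle zt (~-sym ct) (~-sym zc))
        (λ zp pt' pp → no-quadrangle z≢t (≢-sym (≢-if-≁ ce (Far.≁e (P⇒Far pp)))) zp pt' (~-sym ct) (~-sym zc))

    -- Any counted z' reaches v or w through c, so z' and z are both common neighbours of u and c.
    count-via-e : ∀ {u v w} → P u → P v → P w → v ≢ w → Via e v w →
                  DistIn G P u v 2 → DistIn G P u w 2 →
                  CountIs (λ z → P z × DistIn G P z u 1 × DistIn G P z v 3 × DistIn G P z w 3) 1
    count-via-e {u} {v} {w} pu pv pw v≢w (c , (vc , cw) , ce) duv duw =
      z ∷ [] , [] ∷ [] , (λ z' → mk⇔ (λ { (here refl) → counted }) (here ∘ unique)) , refl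
      where
        u≢c : u ≢ c
        u≢c = ≢-sym (≢-if-≁ ce (Far.≁e (P⇒Far pu)))
        apex : ∃ (CommonNeighbour u c)
        apex = common-neighbour u≢c (λ uc → dist₂⇒¬Via-e duv (c , (uc , ~-sym vc) , ce))
        z : V
        z = proj₁ apex
        uz : u ~ z
        uz = proj₁ (proj₂ apex)
        zc : z ~ c
        zc = proj₂ (proj₂ apex)
        pz : P z
        pz = neighbour-in-P pu uz (λ ze → no-triangle ze (~-sym ce) (~-sym zc))
               (λ zf → no-quadrangle (neighbour-≢e pu uz) (neighbour-≢f pv vc) zc ce ef (~-sym zf))
        dist₃-via-c : ∀ {t} → P t → t ~ c → DistIn G P u t 2 → DistIn G P z t 3
        dist₃-via-c pt tc dut = Via-e⇒dist₃ pz pt (λ { refl → dist-2+⇒¬adj dut uz }) (c , (zc , ~-sym tc) , ce)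
        counted : P z × DistIn G P z u 1 × DistIn G P z v 3 × DistIn G P z w 3
        counted = pz , adj⇒dist₁ pz pu (~-sym uz) , dist₃-via-c pv vc duv , dist₃-via-c pw (~-sym cw) duw
        through-c : ∀ {z'} → P z' → DistIn G P z' v 3 → DistIn G P z' w 3 → z' ~ c
        through-c pz' dv dw with dist₃⇒Via dv | dist₃⇒Via dw
        ... | inj₁ via | _        = Via-e-hub pv vc ce via
        ... | inj₂ _   | inj₁ via = Via-e-hub pw (~-sym cw) ce via
        ... | inj₂ via | inj₂ via' with Via-both (Far.≢f (P⇒Far pz')) via via'
        ...   | h , vhw , hf with common-neighbour-unique v≢w vhw (vc , cw)
        ...     | refl = ⊥-elim (no-triangle ce ef (~-sym hf))
        unique : ∀ {z'} → P z' × DistIn G P z' u 1 × DistIn G P z' v 3 × DistIn G P z' w 3 → z' ≡ z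
        unique (pz' , dz'u , dv , dw) =
          common-neighbour-unique u≢c (~-sym (walk₁⇒adj (proj₁ dz'u)) , through-c pz' dv dw) (uz , zc)

  module FarFromEdge {d} (regular : Regular G d) (3<d : 3 < d) {a b} (ab : a ~ b) where

    private
      module A = Oriented regular 3<d ab InΓ⇒Far Far⇒InΓ
      module B = Oriented regular 3<d (~-sym ab) (Far-swap ∘ InΓ⇒Far) (Far⇒InΓ ∘ Far-swap)

    count-1-3-3 : ∀ {u v w} → InΓ G a b u → InΓ G a b v → InΓ G a b w → v ≢ w →
                  dΓ G a b v w 3 → dΓ G a b u v 2 → dΓ G a b u w 2 →
                  CountIs (NPred G a b 1 3 3 u v w) 1
    count-1-3-3 pu pv pw v≢w dvw duv duw with A.dist₃⇒Via dvw
    ... | inj₁ via-a = A.count-via-e pu pv pw v≢w via-a duv duw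
    ... | inj₂ via-b = B.count-via-e pu pv pw v≢w via-b duv duw

    dist₃-to-both-atMost-2 : ∀ {v w} → dΓ G a b v w 2 →
                             AtMost (λ z → dΓ G a b z v 3 × dΓ G a b z w 3) 2
    dist₃-to-both-atMost-2 {v} {w} dvw =
      atMost-mono classify (atMost-⊎ (subsingleton⇒atMost-1 (A.Via-e-f-unique pv pw))
                                     (subsingleton⇒atMost-1 (B.Via-e-f-unique pv pw)))
      where
        pv = walk-source (proj₁ dvw)
        pw = walk-target (proj₁ dvw)
        classify : ∀ {z} → dΓ G a b z v 3 × dΓ G a b z w 3 →
                   (Via a z v × Via b z w) ⊎ (Via b z v × Via a z w)
        classify (dv , dw) with A.dist₃⇒Via dv | A.dist₃⇒Via dw
        ... | inj₁ via-a | inj₂ via-b = inj₁ (via-a , via-b)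
        ... | inj₂ via-b | inj₁ via-a = inj₂ (via-b , via-a)
        ... | inj₁ via-a | inj₁ via-a' =
          ⊥-elim (A.dist₂⇒¬Via-e dvw (Via-both (Far.≢e (InΓ⇒Far (walk-source (proj₁ dv)))) via-a via-a'))
        ... | inj₂ via-b | inj₂ via-b' =
          ⊥-elim (B.dist₂⇒¬Via-e dvw (Via-both (Far.≢f (InΓ⇒Far (walk-source (proj₁ dv)))) via-b via-b'))

lemma3 : (n : ℕ) (G : Graph (Fin n)) → IsMooreDiam2 G 57 →
    (a b : Fin n) → Adj G a b →
    (u v w : Fin n) → InΓ G a b u → InΓ G a b v → InΓ G a b w →
    u ≢ v → u ≢ w → v ≢ w →
    ((dΓ G a b v w 3 → dΓ G a b u w 2 → dΓ G a b u v 2 →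
        CountIs (NPred G a b 1 3 3 u v w) 1)
    × (dΓ G a b v w 2 → dΓ G a b u w 2 → dΓ G a b u v 2 →
        AtMost (NPred G a b 1 3 3 u v w) 2
        × AtMost (NPred G a b 2 3 3 u v w) 2
        × AtMost (NPred G a b 3 1 3 u v w) 2
        × AtMost (NPred G a b 3 2 3 u v w) 2
        × AtMost (NPred G a b 3 3 1 u v w) 2
        × AtMost (NPred G a b 3 3 2 u v w) 2))
lemma3 n G (regular , (diameter≤2 , _) , (_ , _ , _ , no-short-cycle)) a b ab u v w pu pv pw _ _ v≢w =
  (λ dvw duw duv → count-1-3-3 pu pv pw v≢w dvw duv duw) ,
  λ dvw duw duv →
      atMost-mono (λ (_ , _ , dv , dw) → dv , dw) (dist₃-to-both-atMost-2 dvw)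
    , atMost-mono (λ (_ , _ , dv , dw) → dv , dw) (dist₃-to-both-atMost-2 dvw)
    , atMost-mono (λ (_ , du , _ , dw) → du , dw) (dist₃-to-both-atMost-2 duw)
    , atMost-mono (λ (_ , du , _ , dw) → du , dw) (dist₃-to-both-atMost-2 duw)
    , atMost-mono (λ (_ , du , dv , _) → du , dv) (dist₃-to-both-atMost-2 duv)
    , atMost-mono (λ (_ , du , dv , _) → du , dv) (dist₃-to-both-atMost-2 duv)
  where
    open GirthFiveDiameterTwo _≟_ G diameter≤2 no-short-cycle
    open FarFromEdge regular (s≤s (s≤s (s≤s (s≤s z≤n)))) ab
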